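{- Let $X$ be a finite simplicial complex on a vertex set $V$ with $|V|=n$, and suppose $h(X)=d$. Let $k\geq 0$ and $\sigma\in X(k)$. Then \[ \sum_{\tau\in\sigma(k-1)}\deg_X(\tau)-(k-d+1)\deg_X(\sigma)\leq dn-(d-1)(k+1). \]
   Context: $X(k)$ is the set of $k$-dimensional simplices of $X$ and $\sigma(k-1)$ the set of $(k-1)$-dimensional faces of $\sigma$ (for $k=0$ this is $\{\emptyset\}$). A missing face of $X$ is a set $\sigma\subset V$ with $\sigma\notin X$ but $\tau\in X$ for every $\tau\subsetneq\sigma$; $h(X)$ is the maximal dimension of a missing face. For a $j$-simplex $\tau$ of $X$, $\deg_X(\tau)=|\{\eta\in X(j+1):\tau\subset\eta\}|$. -}

module Defs where

open import Data.Nat using (ℕ; zero; suc; _+_)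
open import Data.Bool using (Bool; true; false)
open import Data.Fin.Subset using (Subset; _⊆_; _⊂_; ∣_∣; inside; outside)
open import Data.Fin.Subset.Properties using (_⊆?_)
open import Data.List using (List; []; _∷_; _++_; map; filter; length)
open import Data.Vec using (_∷_; [])
open import Data.Product using (_×_; Σ; _,_)
open import Relation.Nullary using (¬_; Dec)
open import Relation.Nullary.Decidable using (_×-dec_)
open import Relation.Unary using (Pred; Decidable)
open import Level using (0ℓ)

-- A finite simplicial complex on V: a decidable, downward-closed family of subsets of V.
-- (Downward closure together with σ ∈ X forces ∅ ∈ X.)
record Complex (n : ℕ) : Set₁ where
  field
    _∈X : Subset n → Set
    dec : (σ : Subset n) → Dec (σ ∈X)
    down : ∀ {σ τ} → σ ∈X → τ ⊆ σ → τ ∈X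
open Complex public

-- dimension of a face: a j-simplex has j+1 vertices, i.e. ∣ σ ∣ ≡ suc j.
-- All subsets of Fin n, as a list.
allSubsets : (n : ℕ) → List (Subset n)
allSubsets zero = [] ∷ []
allSubsets (suc n) = map (outside ∷_) (allSubsets n) ++ map (inside ∷_) (allSubsets n)

_∈X[_] : ∀ {n} → Subset n → ℕ → Complex n → Set
(σ ∈X[ k ]) X = (X ∈X) σ × ∣ σ ∣ ≡ℕ suc k
  where open import Relation.Binary.PropositionalEquality using () renaming (_≡_ to _≡ℕ_)

-- σ(k-1): the (k-1)-dimensional faces of a k-simplex σ, i.e. τ ⊆ σ with ∣ τ ∣ = k
-- (for k = 0 this is {∅}).
facets : ∀ {n} → Subset n → ℕ → List (Subset n)
facets {n} σ k = filter (λ τ → (τ ⊆? σ) ×-dec (∣ τ ∣ Data.Nat.≟ k)) (allSubsets n)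
  where import Data.Nat

deg : ∀ {n} → Complex n → Subset n → ℕ
deg {n} X τ =
  length (filter (λ η → dec X η ×-dec ((τ ⊆? η) ×-dec (∣ η ∣ Data.Nat.≟ suc ∣ τ ∣))) (allSubsets n))
  where import Data.Nat

MissingFace : ∀ {n} → Complex n → Subset n → Set
MissingFace X σ = ¬ (X ∈X) σ × (∀ τ → τ ⊂ σ → (X ∈X) τ)

_hIs_ : ∀ {n} → Complex n → ℕ → Set
X hIs d = Σ _ (λ σ → MissingFace X σ × ∣ σ ∣ ≡ℕ suc d)
        × (∀ σ → MissingFace X σ → ∣ σ ∣ ≤ℕ suc d)
  where open import Relation.Binary.PropositionalEquality using () renaming (_≡_ to _≡ℕ_)
        open import Data.Nat using () renaming (_≤_ to _≤ℕ_)

module Submission where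

-- Let σ be a k-face of X (so |σ| = k+1) and write  χ η = 1  if η ∈ X and 0 otherwise.
-- For w ∉ σ put  e(w) = #{v ∈ σ : σ - v + w ∈ X},  the number of ways to exchange a vertex
-- of σ for w inside X.  The proof consists of three observations.
--   (1) deg τ = Σ_{w ∉ τ} χ(τ + w), and the facets of σ are the σ - v with v ∈ σ; hence
--       Σ_{τ ∈ σ(k-1)} deg τ = Σ_{v ∈ σ} deg(σ - v) = (k+1) + Σ_{w ∉ σ} e(w).
--   (2) For w ∉ σ:  e(w) + d·χ(σ+w) ≤ d + (k+1)·χ(σ+w).  If σ + w ∈ X this is e(w) ≤ k+1.
--       Otherwise σ + w contains a missing face μ; μ ∌ w is impossible (μ ⊆ σ ∈ X), and every
--       v ∈ σ with σ - v + w ∈ X lies in μ (else μ ⊆ σ - v + w ∈ X), so e(w) + 1 ≤ |μ| ≤ d + 1.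
--   (3) Summing (2) over the n - (k+1) vertices w ∉ σ and inserting (1) gives the theorem after
--       an integer rearrangement.

module Counting where

  open import Data.Bool using (Bool; true; false; not; _∧_; if_then_else_)
  open import Data.Bool.Properties using (not-involutive) renaming (_≟_ to _≟ᵇ_)
  open import Data.Empty using (⊥-elim)
  open import Data.Fin using (Fin; zero; suc)
  open import Data.Fin.Properties using (any?) renaming (_≟_ to _≟ᶠ_)
  open import Data.Fin.Subset using (Subset; _∉_; _⊆_; _⊂_; ∣_∣; inside; outside; ⁅_⁆)
  open import Data.Fin.Subset.Properties using (_⊆?_; p⊆q⇒∣p∣≤∣q∣; ∣⁅x⁆∣≡1; x∈⁅y⁆⇒x≡y; _∈?_)
  open import Data.List using (List; []; _∷_; _++_; map; filter; length)
  open import Data.List.Properties using (map-++; map-∘; map-cong)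
  open import Data.Nat using (ℕ; zero; suc; _+_; _*_; _≤_; z≤n)
  open import Data.Nat.ListAction using (sum)
  open import Data.Nat.ListAction.Properties using (sum-++)
  open import Data.Nat.Properties using (_≟_; +-*-semiring; +-commutativeSemigroup; +-comm; +-identityʳ; +-mono-≤; +-monoˡ-≤; *-zeroʳ; *-identityʳ; ≤-refl; ≤-reflexive; ≤-trans; ≤-pred; <⇒≱; 1+n≢0; suc-injective; module ≤-Reasoning)
  open import Algebra.Properties.Semiring.Sum +-*-semiring using (sum-syntax; sum-cong-≗; sum-replicate-zero; ∑-distrib-+; ∑-comm; *-distribˡ-sum)
  open import Algebra.Properties.CommutativeSemigroup +-commutativeSemigroup using (x∙yz≈y∙xz)
  open import Data.Product using (∃-syntax; _×_; _,_)
  open import Data.Vec using ([]; _∷_; lookup; _[_]≔_)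
  open import Data.Vec.Properties using ([]=⇒lookup; lookup⇒[]=; lookup∘update; lookup∘update′; []≔-minimal; []≔-idempotent; []≔-lookup; []≔-commutes)
  open import Function using (_∘_)
  open import Relation.Binary.PropositionalEquality
  open import Relation.Nullary using (¬_; Dec; yes; no; does; contradiction)
  open import Relation.Nullary.Decidable using (dec-false; decidable-stable; ¬?; _×-dec_)
  open import Relation.Unary using (Pred; Decidable)
  open import Defs

  private
    variable
      n : ℕ

  -- ∑ᵇ b f = Σ { f v ∣ b v = true }: a sum over the vertices selected by a boolean predicate.
  -- Σ_{v ∈ p} is ∑ᵇ (lookup p) and Σ_{w ∉ p} is ∑ᵇ (not ∘ lookup p).
  restrict : (Fin n → Bool) → (Fin n → ℕ) → Fin n → ℕ
  restrict b f v = if b v then f v else 0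

  ∑ᵇ : (Fin n → Bool) → (Fin n → ℕ) → ℕ
  ∑ᵇ {n} b f = ∑[ v < n ] restrict b f v

  -- A relation holding between 0 and 0, and between x and y whenever b holds, holds between
  -- the b-guarded terms; this turns facts about selected summands into facts about all summands.
  guarded : ∀ {R : ℕ → ℕ → Set} b {x y} → R 0 0 → (b ≡ true → R x y) →
            R (if b then x else 0) (if b then y else 0)
  guarded true  R00 Rxy = Rxy refl
  guarded false R00 Rxy = R00

  ∑-mono-≤ : {f g : Fin n → ℕ} → (∀ v → f v ≤ g v) → ∑[ v < n ] f v ≤ ∑[ v < n ] g v
  ∑-mono-≤ {zero}  f≤g = z≤n
  ∑-mono-≤ {suc n} f≤g = +-mono-≤ (f≤g zero) (∑-mono-≤ (f≤g ∘ suc))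

  ∑ᵇ-cong : ∀ (b : Fin n → Bool) {f g} → (∀ v → b v ≡ true → f v ≡ g v) → ∑ᵇ b f ≡ ∑ᵇ b g
  ∑ᵇ-cong b f≡g = sum-cong-≗ (λ v → guarded {R = _≡_} (b v) refl (f≡g v))

  ∑ᵇ-mono-≤ : ∀ (b : Fin n → Bool) {f g} → (∀ v → b v ≡ true → f v ≤ g v) → ∑ᵇ b f ≤ ∑ᵇ b g
  ∑ᵇ-mono-≤ b f≤g = ∑-mono-≤ (λ v → guarded {R = _≤_} (b v) z≤n (f≤g v))

  ∑ᵇ-+ : ∀ (b : Fin n → Bool) f g → ∑ᵇ b (λ v → f v + g v) ≡ ∑ᵇ b f + ∑ᵇ b g
  ∑ᵇ-+ b f g = trans (sum-cong-≗ split) (∑-distrib-+ (restrict b f) (restrict b g))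
    where
    split : ∀ v → (if b v then f v + g v else 0) ≡ (if b v then f v else 0) + (if b v then g v else 0)
    split v with b v
    ... | true  = refl
    ... | false = refl

  ∑ᵇ-* : ∀ (b : Fin n → Bool) c f → ∑ᵇ b (λ v → c * f v) ≡ c * ∑ᵇ b f
  ∑ᵇ-* b c f = trans (sum-cong-≗ factor) (sym (*-distribˡ-sum c (restrict b f)))
    where
    factor : ∀ v → (if b v then c * f v else 0) ≡ c * (if b v then f v else 0)
    factor v with b v
    ... | true  = refl
    ... | false = sym (*-zeroʳ c)

  ∑ᵇ-comm : ∀ (a b : Fin n → Bool) (t : Fin n → Fin n → ℕ) →
            ∑ᵇ a (λ v → ∑ᵇ b (t v)) ≡ ∑ᵇ b (λ w → ∑ᵇ a (λ v → t v w))
  ∑ᵇ-comm {n} a b t = trans (sum-cong-≗ inner) (trans (∑-comm both) (sym (sum-cong-≗ outer)))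
    where
    if-zero : ∀ c → (if c then 0 else 0) ≡ 0
    if-zero true  = refl
    if-zero false = refl
    both : Fin n → Fin n → ℕ
    both v w = if a v then (if b w then t v w else 0) else 0
    inner : ∀ v → (if a v then ∑ᵇ b (t v) else 0) ≡ ∑[ w < n ] both v w
    inner v with a v
    ... | true  = refl
    ... | false = sym (sum-replicate-zero n)
    outer : ∀ w → (if b w then ∑ᵇ a (λ v → t v w) else 0) ≡ ∑[ v < n ] both v w
    outer w with b w
    ... | true  = refl
    ... | false = trans (sym (sum-replicate-zero n)) (sum-cong-≗ (λ v → sym (if-zero (a v))))

  ∑ᵇ-complement : ∀ (b : Fin n → Bool) f → ∑ᵇ b f + ∑ᵇ (not ∘ b) f ≡ ∑[ v < n ] f v
  ∑ᵇ-complement b f = trans (sym (∑-distrib-+ (restrict b f) (restrict (not ∘ b) f))) (sum-cong-≗ recombine)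
    where
    recombine : ∀ v → (if b v then f v else 0) + (if not (b v) then f v else 0) ≡ f v
    recombine v with b v
    ... | true  = +-identityʳ (f v)
    ... | false = refl

  ∑-ones : ∀ n → ∑[ v < n ] 1 ≡ n
  ∑-ones zero    = refl
  ∑-ones (suc n) = cong suc (∑-ones n)

  ∑ᵇ-card : (p : Subset n) → ∑ᵇ (lookup p) (λ _ → 1) ≡ ∣ p ∣
  ∑ᵇ-card []          = refl
  ∑ᵇ-card (true  ∷ p) = cong suc (∑ᵇ-card p)
  ∑ᵇ-card (false ∷ p) = ∑ᵇ-card p

  outside-count : (p : Subset n) {m : ℕ} → ∣ p ∣ ≡ m → ∑ᵇ (not ∘ lookup p) (λ _ → 1) + m ≡ n
  outside-count {n} p refl = begin
    ∑ᵇ (not ∘ lookup p) (λ _ → 1) + ∣ p ∣                  ≡⟨ cong (∑ᵇ (not ∘ lookup p) (λ _ → 1) +_) (∑ᵇ-card p) ⟨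
    ∑ᵇ (not ∘ lookup p) (λ _ → 1) + ∑ᵇ (lookup p) (λ _ → 1) ≡⟨ +-comm (∑ᵇ (not ∘ lookup p) (λ _ → 1)) _ ⟩
    ∑ᵇ (lookup p) (λ _ → 1) + ∑ᵇ (not ∘ lookup p) (λ _ → 1) ≡⟨ ∑ᵇ-complement (lookup p) (λ _ → 1) ⟩
    ∑[ v < n ] 1                                            ≡⟨ ∑-ones n ⟩
    n                                                       ∎
    where open ≡-Reasoning

  ∑-outside-delete : (p : Subset n) (v : Fin n) (f : Fin n → ℕ) → lookup p v ≡ true →
    ∑ᵇ (not ∘ lookup (p [ v ]≔ outside)) f ≡ f v + ∑ᵇ (not ∘ lookup p) f
  ∑-outside-delete (true ∷ p) zero    f refl = refl
  ∑-outside-delete (b    ∷ p) (suc v) f v∈p  =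
    trans (cong (restrict (not ∘ lookup (b ∷ p)) f zero +_) (∑-outside-delete p v (f ∘ suc) v∈p))
          (x∙yz≈y∙xz (restrict (not ∘ lookup (b ∷ p)) f zero) (f (suc v)) (∑ᵇ (not ∘ lookup p) (f ∘ suc)))

  -- Adding and deleting single vertices.  In sums a point v of a subset p is tested by
  -- lookup p v, so "v ∈ p" appears as lookup p v ≡ true where sums are involved.

  update-restore : (p : Subset n) (v : Fin n) {b c : Bool} → lookup p v ≡ b → (p [ v ]≔ c) [ v ]≔ b ≡ p
  update-restore p v refl = trans ([]≔-idempotent p v) ([]≔-lookup p v)

  ∣delete∣ : (p : Subset n) (v : Fin n) → lookup p v ≡ true → suc ∣ p [ v ]≔ outside ∣ ≡ ∣ p ∣
  ∣delete∣ (true  ∷ p) zero    refl = refl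
  ∣delete∣ (true  ∷ p) (suc v) v∈p  = cong suc (∣delete∣ p v v∈p)
  ∣delete∣ (false ∷ p) (suc v) v∈p  = ∣delete∣ p v v∈p

  delete-⊆ : (p : Subset n) (v : Fin n) → p [ v ]≔ outside ⊆ p
  delete-⊆ p v {y} y∈p-v with y ≟ᶠ v
  ... | yes refl = contradiction (trans (sym ([]=⇒lookup y∈p-v)) (lookup∘update v p outside)) λ ()
  ... | no  y≢v  = lookup⇒[]= y p (trans (sym (lookup∘update′ y≢v p outside)) ([]=⇒lookup y∈p-v))

  ⊆-delete : ∀ {τ ρ : Subset n} {x} → τ ⊆ ρ → x ∉ τ → τ ⊆ ρ [ x ]≔ outside
  ⊆-delete {ρ = ρ} {x} τ⊆ρ x∉τ {y} y∈τ = []≔-minimal ρ y x y≢x (τ⊆ρ y∈τ)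
    where
    y≢x : y ≢ x
    y≢x refl = x∉τ y∈τ

  sum-map-filter : ∀ {A : Set} {p} {P : Pred A p} (P? : Decidable P) (g : A → ℕ) (xs : List A) →
                   sum (map g (filter P? xs)) ≡ sum (map (λ x → if does (P? x) then g x else 0) xs)
  sum-map-filter P? g []       = refl
  sum-map-filter P? g (x ∷ xs) with does (P? x)
  ... | true  = cong (g x +_) (sum-map-filter P? g xs)
  ... | false = sum-map-filter P? g xs

  length-filter : ∀ {A : Set} {p} {P : Pred A p} (P? : Decidable P) (xs : List A) →
                  length (filter P? xs) ≡ sum (map (λ x → if does (P? x) then 1 else 0) xs)
  length-filter P? []       = refl
  length-filter P? (x ∷ xs) with does (P? x)
  ... | true  = cong suc (length-filter P? xs)
  ... | false = length-filter P? xs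

  ∑ₛ : (n : ℕ) → (Subset n → ℕ) → ℕ
  ∑ₛ n f = sum (map f (allSubsets n))

  ∑ₛ-cong : ∀ n {f g : Subset n → ℕ} → (∀ η → f η ≡ g η) → ∑ₛ n f ≡ ∑ₛ n g
  ∑ₛ-cong n f≡g = cong sum (map-cong f≡g (allSubsets n))

  ∑ₛ-suc : ∀ n (f : Subset (suc n) → ℕ) → ∑ₛ (suc n) f ≡ ∑ₛ n (f ∘ (outside ∷_)) + ∑ₛ n (f ∘ (inside ∷_))
  ∑ₛ-suc n f = begin
    sum (map f (map (outside ∷_) Ss ++ map (inside ∷_) Ss))
      ≡⟨ cong sum (map-++ f (map (outside ∷_) Ss) _) ⟩
    sum (map f (map (outside ∷_) Ss) ++ map f (map (inside ∷_) Ss))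
      ≡⟨ sum-++ (map f (map (outside ∷_) Ss)) _ ⟩
    sum (map f (map (outside ∷_) Ss)) + sum (map f (map (inside ∷_) Ss))
      ≡⟨ cong₂ _+_ (cong sum (map-∘ Ss)) (cong sum (map-∘ Ss)) ⟨
    ∑ₛ n (f ∘ (outside ∷_)) + ∑ₛ n (f ∘ (inside ∷_))
      ∎
    where
    open ≡-Reasoning
    Ss : List (Subset n)
    Ss = allSubsets n

  ∑ₛ-vanishes : ∀ n {f : Subset n → ℕ} → (∀ η → f η ≡ 0) → ∑ₛ n f ≡ 0
  ∑ₛ-vanishes zero    f≡0 = cong (_+ 0) (f≡0 [])
  ∑ₛ-vanishes (suc n) f≡0 =
    trans (∑ₛ-suc n _) (cong₂ _+_ (∑ₛ-vanishes n (f≡0 ∘ (outside ∷_))) (∑ₛ-vanishes n (f≡0 ∘ (inside ∷_))))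

  guard-fails : ∀ {A : Set} (a? : Dec A) {b : Bool} {x : ℕ} → (A → b ≡ false) → (if does a? ∧ b then x else 0) ≡ 0
  guard-fails (no _)  _       = refl
  guard-fails (yes a) refutes rewrite refutes a = refl

  supersets-same-size : (τ : Subset n) (f : Subset n → ℕ) →
    ∑ₛ n (λ η → if does (τ ⊆? η) ∧ does (∣ η ∣ ≟ ∣ τ ∣) then f η else 0) ≡ f τ
  supersets-same-size [] f = +-identityʳ (f [])
  supersets-same-size {suc n} (outside ∷ τ) f =
    trans (∑ₛ-suc n _) (trans (cong₂ _+_ (supersets-same-size τ (f ∘ (outside ∷_))) (∑ₛ-vanishes n larger)) (+-identityʳ _))
    where
    larger : ∀ η → (if does (τ ⊆? η) ∧ does (suc ∣ η ∣ ≟ ∣ τ ∣) then f (inside ∷ η) else 0) ≡ 0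
    larger η = guard-fails (τ ⊆? η) (λ τ⊆η → dec-false (suc ∣ η ∣ ≟ ∣ τ ∣) (λ eq → <⇒≱ (≤-reflexive eq) (p⊆q⇒∣p∣≤∣q∣ τ⊆η)))
  supersets-same-size {suc n} (inside ∷ τ) f =
    trans (∑ₛ-suc n _) (cong₂ _+_ (∑ₛ-vanishes n (λ _ → refl)) (supersets-same-size τ (f ∘ (inside ∷_))))

  subsets-same-size : (σ : Subset n) (f : Subset n → ℕ) →
    ∑ₛ n (λ η → if does (η ⊆? σ) ∧ does (∣ η ∣ ≟ ∣ σ ∣) then f η else 0) ≡ f σ
  subsets-same-size [] f = +-identityʳ (f [])
  subsets-same-size {suc n} (outside ∷ σ) f =
    trans (∑ₛ-suc n _) (trans (cong₂ _+_ (subsets-same-size σ (f ∘ (outside ∷_))) (∑ₛ-vanishes n (λ _ → refl))) (+-identityʳ _))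
  subsets-same-size {suc n} (inside ∷ σ) f =
    trans (∑ₛ-suc n _) (cong₂ _+_ (∑ₛ-vanishes n smaller) (subsets-same-size σ (f ∘ (inside ∷_))))
    where
    smaller : ∀ η → (if does (η ⊆? σ) ∧ does (∣ η ∣ ≟ suc ∣ σ ∣) then f (outside ∷ η) else 0) ≡ 0
    smaller η = guard-fails (η ⊆? σ) (λ η⊆σ → dec-false (∣ η ∣ ≟ suc ∣ σ ∣) (λ eq → <⇒≱ (≤-reflexive (sym eq)) (p⊆q⇒∣p∣≤∣q∣ η⊆σ)))

  cofaces-sum : (τ : Subset n) (f : Subset n → ℕ) →
    ∑ₛ n (λ η → if does (τ ⊆? η) ∧ does (∣ η ∣ ≟ suc ∣ τ ∣) then f η else 0)
      ≡ ∑ᵇ (not ∘ lookup τ) (λ w → f (τ [ w ]≔ inside))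
  cofaces-sum [] f = refl
  cofaces-sum {suc n} (outside ∷ τ) f =
    trans (∑ₛ-suc n _)
      (trans (cong₂ _+_ (cofaces-sum τ (f ∘ (outside ∷_))) (supersets-same-size τ (f ∘ (inside ∷_))))
        (+-comm (∑ᵇ (not ∘ lookup τ) (λ w → f (outside ∷ (τ [ w ]≔ inside)))) (f (inside ∷ τ))))
  cofaces-sum {suc n} (inside ∷ τ) f =
    trans (∑ₛ-suc n _) (cong₂ _+_ (∑ₛ-vanishes n (λ _ → refl)) (cofaces-sum τ (f ∘ (inside ∷_))))

  facets-sum : (σ : Subset n) (f : Subset n → ℕ) →
    ∑ₛ n (λ η → if does (η ⊆? σ) ∧ does (suc ∣ η ∣ ≟ ∣ σ ∣) then f η else 0)
      ≡ ∑ᵇ (lookup σ) (λ v → f (σ [ v ]≔ outside))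
  facets-sum [] f = refl
  facets-sum {suc n} (outside ∷ σ) f =
    trans (∑ₛ-suc n _) (trans (cong₂ _+_ (facets-sum σ (f ∘ (outside ∷_))) (∑ₛ-vanishes n (λ _ → refl))) (+-identityʳ _))
  facets-sum {suc n} (inside ∷ σ) f =
    trans (∑ₛ-suc n _) (cong₂ _+_ (subsets-same-size σ (f ∘ (outside ∷_))) (facets-sum σ (f ∘ (inside ∷_))))

  module _ {n} (X : Complex n) where

    χ : Subset n → ℕ
    χ η = if does (dec X η) then 1 else 0

    χ-face : ∀ {η} → (X ∈X) η → χ η ≡ 1
    χ-face {η} η∈X with dec X η
    ... | yes _    = refl
    ... | no  η∉X  = ⊥-elim (η∉X η∈X)

    χ-≤-indicator : ∀ η {b} → ((X ∈X) η → b ≡ true) → χ η ≤ (if b then 1 else 0)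
    χ-≤-indicator η forced with dec X η
    ... | no  _   = z≤n
    ... | yes η∈X rewrite forced η∈X = ≤-refl

    -- Every non-face ρ contains a missing face: while some one-vertex deletion of ρ is a
    -- non-face pass to it, otherwise every proper subset of ρ is a face (recursion on m = |ρ|).
    missing-face-below : ∀ m (ρ : Subset n) → ∣ ρ ∣ ≡ m → ¬ (X ∈X) ρ → ∃[ μ ] μ ⊆ ρ × MissingFace X μ
    missing-face-below m ρ ∣ρ∣≡m ρ∉X with any? (λ v → (lookup ρ v ≟ᵇ true) ×-dec ¬? (dec X (ρ [ v ]≔ outside)))
    ... | no no-deletion = ρ , (λ x∈ρ → x∈ρ) , ρ∉X , proper-subsets-are-faces
      where
      proper-subsets-are-faces : ∀ τ → τ ⊂ ρ → (X ∈X) τ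
      proper-subsets-are-faces τ (τ⊆ρ , x , x∈ρ , x∉τ) =
        down X (decidable-stable (dec X _) (λ ρ-x∉X → no-deletion (x , []=⇒lookup x∈ρ , ρ-x∉X))) (⊆-delete τ⊆ρ x∉τ)
    ... | yes (v , v∈ρ , ρ-v∉X) = shrink m ∣ρ∣≡m
      where
      shrink : ∀ m → ∣ ρ ∣ ≡ m → ∃[ μ ] μ ⊆ ρ × MissingFace X μ
      shrink zero    ∣ρ∣≡0   = ⊥-elim (1+n≢0 (trans (∣delete∣ ρ v v∈ρ) ∣ρ∣≡0))
      shrink (suc m) ∣ρ∣≡1+m with missing-face-below m (ρ [ v ]≔ outside) (suc-injective (trans (∣delete∣ ρ v v∈ρ) ∣ρ∣≡1+m)) ρ-v∉X
      ... | μ , μ⊆ρ-v , μ-missing = μ , delete-⊆ ρ v ∘ μ⊆ρ-v , μ-missing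

    deg-as-sum : (τ : Subset n) → deg X τ ≡ ∑ᵇ (not ∘ lookup τ) (λ w → χ (τ [ w ]≔ inside))
    deg-as-sum τ = begin
      deg X τ
        ≡⟨ length-filter _ (allSubsets n) ⟩
      ∑ₛ n (λ η → if does (dec X η) ∧ coface η then 1 else 0)
        ≡⟨ ∑ₛ-cong n (λ η → move-guard (does (dec X η)) (coface η)) ⟩
      ∑ₛ n (λ η → if coface η then χ η else 0)
        ≡⟨ cofaces-sum τ χ ⟩
      ∑ᵇ (not ∘ lookup τ) (λ w → χ (τ [ w ]≔ inside))
        ∎
      where
      open ≡-Reasoning
      coface : Subset n → Bool
      coface η = does (τ ⊆? η) ∧ does (∣ η ∣ ≟ suc ∣ τ ∣)
      move-guard : ∀ a b → (if a ∧ b then 1 else 0) ≡ (if b then (if a then 1 else 0) else 0)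
      move-guard true  b     = refl
      move-guard false true  = refl
      move-guard false false = refl

    facet-degrees : (σ : Subset n) (k : ℕ) → ∣ σ ∣ ≡ suc k →
      sum (map (deg X) (facets σ k)) ≡ ∑ᵇ (lookup σ) (λ v → deg X (σ [ v ]≔ outside))
    facet-degrees σ k ∣σ∣≡1+k = begin
      sum (map (deg X) (facets σ k))
        ≡⟨ sum-map-filter _ (deg X) (allSubsets n) ⟩
      ∑ₛ n (λ η → if does (η ⊆? σ) ∧ does (suc ∣ η ∣ ≟ suc k) then deg X η else 0)
        ≡⟨ cong (λ m → ∑ₛ n (λ η → if does (η ⊆? σ) ∧ does (suc ∣ η ∣ ≟ m) then deg X η else 0)) ∣σ∣≡1+k ⟨
      ∑ₛ n (λ η → if does (η ⊆? σ) ∧ does (suc ∣ η ∣ ≟ ∣ σ ∣) then deg X η else 0)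
        ≡⟨ facets-sum σ (deg X) ⟩
      ∑ᵇ (lookup σ) (λ v → deg X (σ [ v ]≔ outside))
        ∎
      where open ≡-Reasoning

    exchange : Subset n → Fin n → Fin n → Subset n
    exchange σ v w = (σ [ v ]≔ outside) [ w ]≔ inside

    exchanges : Subset n → Fin n → ℕ
    exchanges σ w = ∑ᵇ (lookup σ) (λ v → χ (exchange σ v w))

    -- (1) For a face σ and v ∈ σ the cofaces of σ - v are σ itself and the σ - v + w, w ∉ σ.
    deg-facet : ∀ {σ v} → (X ∈X) σ → lookup σ v ≡ true →
      deg X (σ [ v ]≔ outside) ≡ 1 + ∑ᵇ (not ∘ lookup σ) (λ w → χ (exchange σ v w))
    deg-facet {σ} {v} σ∈X v∈σ = begin
      deg X (σ [ v ]≔ outside)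
        ≡⟨ deg-as-sum (σ [ v ]≔ outside) ⟩
      ∑ᵇ (not ∘ lookup (σ [ v ]≔ outside)) (λ w → χ (exchange σ v w))
        ≡⟨ ∑-outside-delete σ v (λ w → χ (exchange σ v w)) v∈σ ⟩
      χ (exchange σ v v) + ∑ᵇ (not ∘ lookup σ) (λ w → χ (exchange σ v w))
        ≡⟨ cong (_+ ∑ᵇ (not ∘ lookup σ) (λ w → χ (exchange σ v w))) σ-v+v-is-face ⟩
      1 + ∑ᵇ (not ∘ lookup σ) (λ w → χ (exchange σ v w))
        ∎
      where
      open ≡-Reasoning
      σ-v+v-is-face : χ (exchange σ v v) ≡ 1
      σ-v+v-is-face = trans (cong χ (update-restore σ v v∈σ)) (χ-face σ∈X)

    facet-degree-sum : ∀ {σ} → (X ∈X) σ →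
      ∑ᵇ (lookup σ) (λ v → deg X (σ [ v ]≔ outside)) ≡ ∣ σ ∣ + ∑ᵇ (not ∘ lookup σ) (exchanges σ)
    facet-degree-sum {σ} σ∈X = begin
      ∑ᵇ (lookup σ) (λ v → deg X (σ [ v ]≔ outside))
        ≡⟨ ∑ᵇ-cong (lookup σ) (λ v v∈σ → deg-facet σ∈X v∈σ) ⟩
      ∑ᵇ (lookup σ) (λ v → 1 + ∑ᵇ (not ∘ lookup σ) (λ w → χ (exchange σ v w)))
        ≡⟨ ∑ᵇ-+ (lookup σ) (λ _ → 1) (λ v → ∑ᵇ (not ∘ lookup σ) (λ w → χ (exchange σ v w))) ⟩
      ∑ᵇ (lookup σ) (λ _ → 1) + ∑ᵇ (lookup σ) (λ v → ∑ᵇ (not ∘ lookup σ) (λ w → χ (exchange σ v w)))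
        ≡⟨ cong₂ _+_ (∑ᵇ-card σ) (∑ᵇ-comm (lookup σ) (not ∘ lookup σ) (λ v w → χ (exchange σ v w))) ⟩
      ∣ σ ∣ + ∑ᵇ (not ∘ lookup σ) (exchanges σ)
        ∎
      where open ≡-Reasoning

    exchanges-≤-size : ∀ σ w → exchanges σ w ≤ ∣ σ ∣
    exchanges-≤-size σ w = begin
      exchanges σ w             ≤⟨ ∑ᵇ-mono-≤ (lookup σ) (λ v _ → χ-≤-indicator (exchange σ v w) (λ _ → refl)) ⟩
      ∑ᵇ (lookup σ) (λ _ → 1)  ≡⟨ ∑ᵇ-card σ ⟩
      ∣ σ ∣                     ∎
      where open ≤-Reasoning

    module _ {σ μ : Subset n} {w : Fin n} (σ∈X : (X ∈X) σ) (w∉σ : lookup σ w ≡ false)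
             (μ⊆σ+w : μ ⊆ σ [ w ]≔ inside) (μ∉X : ¬ (X ∈X) μ) where

      -- w ∈ μ, since otherwise μ ⊆ (σ + w) - w = σ would be a face.
      w∈μ : lookup μ w ≡ true
      w∈μ with w ∈? μ
      ... | yes w∈μ = []=⇒lookup w∈μ
      ... | no  w∉μ = ⊥-elim (μ∉X (down X σ∈X (subst (μ ⊆_) (update-restore σ w w∉σ) (⊆-delete μ⊆σ+w w∉μ))))

      -- v ∈ σ with σ - v + w ∈ X lies in μ, since otherwise μ ⊆ (σ + w) - v = σ - v + w.
      exchanged-∈-μ : ∀ {v} → lookup σ v ≡ true → (X ∈X) (exchange σ v w) → lookup μ v ≡ true
      exchanged-∈-μ {v} v∈σ σ-v+w∈X with v ∈? μ
      ... | yes v∈μ = []=⇒lookup v∈μ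
      ... | no  v∉μ = ⊥-elim (μ∉X (down X σ-v+w∈X (subst (μ ⊆_) swap-updates (⊆-delete μ⊆σ+w v∉μ))))
        where
        w≢v : w ≢ v
        w≢v refl = contradiction (trans (sym v∈σ) w∉σ) λ ()
        swap-updates : (σ [ w ]≔ inside) [ v ]≔ outside ≡ exchange σ v w
        swap-updates = []≔-commutes σ w v w≢v

      -- Pointwise: v counts on the left (as an exchange, or as v = w) only if v ∈ μ.
      counted-in-μ : ∀ v → (if lookup σ v then χ (exchange σ v w) else 0) + (if lookup ⁅ w ⁆ v then 1 else 0)
                         ≤ (if lookup μ v then 1 else 0)
      counted-in-μ v with lookup ⁅ w ⁆ v in v∈⁅w⁆
      ... | true with x∈⁅y⁆⇒x≡y w (lookup⇒[]= v ⁅ w ⁆ v∈⁅w⁆)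
      ...   | refl rewrite w∉σ | w∈μ = ≤-refl
      counted-in-μ v | false with lookup σ v in v∈σ
      ...   | false = z≤n
      ...   | true  = ≤-trans (≤-reflexive (+-identityʳ _)) (χ-≤-indicator (exchange σ v w) (exchanged-∈-μ v∈σ))

      exchanges-<-missing : suc (exchanges σ w) ≤ ∣ μ ∣
      exchanges-<-missing = begin
        suc (exchanges σ w)                                   ≡⟨ +-comm 1 (exchanges σ w) ⟩
        exchanges σ w + 1                                     ≡⟨ cong (exchanges σ w +_) singleton ⟨
        exchanges σ w + ∑ᵇ (lookup ⁅ w ⁆) (λ _ → 1)           ≡⟨ ∑-distrib-+ (restrict (lookup σ) (λ v → χ (exchange σ v w))) (restrict (lookup ⁅ w ⁆) (λ _ → 1)) ⟨
        ∑[ v < n ] (restrict (lookup σ) (λ v → χ (exchange σ v w)) v + restrict (lookup ⁅ w ⁆) (λ _ → 1) v)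
                                                              ≤⟨ ∑-mono-≤ counted-in-μ ⟩
        ∑ᵇ (lookup μ) (λ _ → 1)                               ≡⟨ ∑ᵇ-card μ ⟩
        ∣ μ ∣                                                 ∎
        where
        open ≤-Reasoning
        singleton : ∑ᵇ (lookup ⁅ w ⁆) (λ _ → 1) ≡ 1
        singleton = trans (∑ᵇ-card ⁅ w ⁆) (∣⁅x⁆∣≡1 w)

    exchange-bound : ∀ {d k σ w} → (∀ μ → MissingFace X μ → ∣ μ ∣ ≤ suc d) →
      (X ∈X) σ → ∣ σ ∣ ≡ suc k → lookup σ w ≡ false →
      exchanges σ w + d * χ (σ [ w ]≔ inside) ≤ d + suc k * χ (σ [ w ]≔ inside)
    exchange-bound {d} {k} {σ} {w} small-missing σ∈X ∣σ∣≡1+k w∉σ with dec X (σ [ w ]≔ inside)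
    ... | yes _ = begin
      exchanges σ w + d * 1  ≡⟨ cong (exchanges σ w +_) (*-identityʳ d) ⟩
      exchanges σ w + d      ≤⟨ +-monoˡ-≤ d (exchanges-≤-size σ w) ⟩
      ∣ σ ∣ + d              ≡⟨ cong (_+ d) ∣σ∣≡1+k ⟩
      suc k + d              ≡⟨ +-comm (suc k) d ⟩
      d + suc k              ≡⟨ cong (d +_) (*-identityʳ (suc k)) ⟨
      d + suc k * 1          ∎
      where open ≤-Reasoning
    ... | no σ+w∉X with missing-face-below _ (σ [ w ]≔ inside) refl σ+w∉X
    ...   | μ , μ⊆σ+w , μ-missing@(μ∉X , _) = begin
      exchanges σ w + d * 0  ≡⟨ cong (exchanges σ w +_) (*-zeroʳ d) ⟩
      exchanges σ w + 0      ≡⟨ +-identityʳ (exchanges σ w) ⟩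
      exchanges σ w          ≤⟨ ≤-pred (≤-trans (exchanges-<-missing σ∈X w∉σ μ⊆σ+w μ∉X) (small-missing μ μ-missing)) ⟩
      d                      ≡⟨ +-identityʳ d ⟨
      d + 0                  ≡⟨ cong (d +_) (*-zeroʳ (suc k)) ⟨
      d + suc k * 0          ∎
      where open ≤-Reasoning

    facet-degree-total : ∀ {σ k} → (X ∈X) σ → ∣ σ ∣ ≡ suc k →
      sum (map (deg X) (facets σ k)) ≡ suc k + ∑ᵇ (not ∘ lookup σ) (exchanges σ)
    facet-degree-total {σ} {k} σ∈X ∣σ∣≡1+k =
      trans (facet-degrees σ k ∣σ∣≡1+k) (trans (facet-degree-sum σ∈X) (cong (_+ ∑ᵇ (not ∘ lookup σ) (exchanges σ)) ∣σ∣≡1+k))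

    summed-bound : ∀ {d k σ} → (∀ μ → MissingFace X μ → ∣ μ ∣ ≤ suc d) → (X ∈X) σ → ∣ σ ∣ ≡ suc k →
      ∑ᵇ (not ∘ lookup σ) (exchanges σ) + d * deg X σ ≤ d * ∑ᵇ (not ∘ lookup σ) (λ _ → 1) + suc k * deg X σ
    summed-bound {d} {k} {σ} small-missing σ∈X ∣σ∣≡1+k = begin
      ∑ᵇ out (exchanges σ) + d * deg X σ
        ≡⟨ cong (λ D → ∑ᵇ out (exchanges σ) + d * D) (deg-as-sum σ) ⟩
      ∑ᵇ out (exchanges σ) + d * ∑ᵇ out a
        ≡⟨ trans (∑ᵇ-+ out (exchanges σ) (λ w → d * a w)) (cong (∑ᵇ out (exchanges σ) +_) (∑ᵇ-* out d a)) ⟨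
      ∑ᵇ out (λ w → exchanges σ w + d * a w)
        ≤⟨ ∑ᵇ-mono-≤ out (λ w w∉σ → exchange-bound small-missing σ∈X ∣σ∣≡1+k (not-true w∉σ)) ⟩
      ∑ᵇ out (λ w → d + suc k * a w)
        ≡⟨ ∑ᵇ-+ out (λ _ → d) (λ w → suc k * a w) ⟩
      ∑ᵇ out (λ _ → d) + ∑ᵇ out (λ w → suc k * a w)
        ≡⟨ cong₂ _+_ (trans (∑ᵇ-cong out (λ _ _ → sym (*-identityʳ d))) (∑ᵇ-* out d (λ _ → 1))) (∑ᵇ-* out (suc k) a) ⟩
      d * ∑ᵇ out (λ _ → 1) + suc k * ∑ᵇ out a
        ≡⟨ cong (λ D → d * ∑ᵇ out (λ _ → 1) + suc k * D) (deg-as-sum σ) ⟨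
      d * ∑ᵇ out (λ _ → 1) + suc k * deg X σ
        ∎
      where
      open ≤-Reasoning
      out : Fin n → Bool
      out = not ∘ lookup σ
      a : Fin n → ℕ
      a w = χ (σ [ w ]≔ inside)
      not-true : ∀ {b} → not b ≡ true → b ≡ false
      not-true {b} not-b = trans (sym (not-involutive b)) (cong not not-b)

-- (3) The integer form of the theorem is the inequality of summed-bound shifted by the
-- integer (k+1) - (k+1)·A, where A = deg σ.
module Rearrangement where

  open import Data.Nat as ℕ using (ℕ; suc)
  open import Data.Integer using (ℤ; +_; _+_; _-_; _*_; _≤_; +≤+)
  open import Data.Integer.Properties using (pos-*; +-monoˡ-≤; module ≤-Reasoning)
  open import Data.Integer.Tactic.RingSolver using (solve-∀)
  open import Relation.Binary.PropositionalEquality using (_≡_; refl; cong; cong₂)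

  left-form : ∀ (k d E A : ℤ) → (+ 1 + k + E) - (k - d + + 1) * A ≡ (E + d * A) + ((+ 1 + k) - (+ 1 + k) * A)
  left-form = solve-∀

  right-form : ∀ (k d M A : ℤ) → d * (M + (+ 1 + k)) - (d - + 1) * (k + + 1) ≡ (d * M + (+ 1 + k) * A) + ((+ 1 + k) - (+ 1 + k) * A)
  right-form = solve-∀

  rearrange : ∀ {k d E A M S N : ℕ} → S ≡ suc k ℕ.+ E → M ℕ.+ suc k ≡ N →
    E ℕ.+ d ℕ.* A ℕ.≤ d ℕ.* M ℕ.+ suc k ℕ.* A →
    + S - (+ k - + d + + 1) * + A ≤ + d * + N - (+ d - + 1) * (+ k + + 1)
  rearrange {k} {d} {E} {A} {M} refl refl bound = begin
    + (suc k ℕ.+ E) - (+ k - + d + + 1) * + A     ≡⟨ left-form (+ k) (+ d) (+ E) (+ A) ⟩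
    + E + + d * + A + shift                        ≡⟨ cong (λ dA → + E + dA + shift) (pos-* d A) ⟨
    + (E ℕ.+ d ℕ.* A) + shift                      ≤⟨ +-monoˡ-≤ shift (+≤+ bound) ⟩
    + (d ℕ.* M ℕ.+ suc k ℕ.* A) + shift            ≡⟨ cong₂ (λ dM kA → dM + kA + shift) (pos-* d M) (pos-* (suc k) A) ⟩
    + d * + M + + suc k * + A + shift              ≡⟨ right-form (+ k) (+ d) (+ M) (+ A) ⟨
    + d * + (M ℕ.+ suc k) - (+ d - + 1) * (+ k + + 1) ∎
    where
    open ≤-Reasoning
    shift : ℤ
    shift = + suc k - + suc k * + A

open import Defs
open import Data.Nat using (ℕ)
open import Data.Integer using (+_; _+_; _-_; _*_; _≤_)
open import Data.List using (map)
open import Data.Nat.ListAction using (sum)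
open import Data.Product using (_,_)
open Counting using (facet-degree-total; outside-count; summed-bound)
open Rearrangement using (rearrange)

lemma1p4 : (n : ℕ) (X : Complex n) (d : ℕ) → X hIs d →
    (k : ℕ) (σ : _) → (σ ∈X[ k ]) X →
    (+ sum (map (deg X) (facets σ k))) - (+ k - + d + + 1) * (+ deg X σ)
      ≤ + d * + n - (+ d - + 1) * (+ k + + 1)
lemma1p4 n X d (_ , small-missing) k σ (σ∈X , ∣σ∣≡1+k) =
  rearrange {d = d} {A = deg X σ} (facet-degree-total X σ∈X ∣σ∣≡1+k) (outside-count σ ∣σ∣≡1+k) (summed-bound X small-missing σ∈X ∣σ∣≡1+k)
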